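{- Let $G=(V,E)$ be a graph with $m$ edges and arboricity at most $\lambda$, let $T=\sqrt{m\log m\cdot\lambda}$, $V_{high}^*=\{v\in V\mid \deg(v)\ge 20T\}$ and $A^*=N(V_{high}^*)\setminus V_{high}^*$. Run the following procedure (Stage 1): set $K_1=V_{high}^*$; for $i=1,\dots,\lceil\log m\rceil$: for $u\in A^*$ let $\mathrm{unitcost}_i(u)=\frac{\deg(u)}{|N(u)\cap K_i|}$; for $v\in K_i$ let $S_i(v)$ be the multiset $\{\mathrm{unitcost}_i(u)\mid u\in N(v)\cap A^*\}$ and $p(v)$ a median of $S_i(v)$; let $L_i=\{v\in K_i\mid p(v)\le \frac{m}{|K_i|\cdot T}\}$, set $level^*(v)=i$ and $candidate^*(v)=\{u\in N(v)\cap A^*\mid \mathrm{unitcost}_i(u)\le p(v)\}$ for $v\in L_i$, and let $K_{i+1}=K_i\setminus L_i$. Then after the loop every vertex of $V_{high}^*$ has been assigned a level, i.e. $K_{\lceil\log m\rceil+1}=\emptyset$.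
   Context: $N(v)$ is the neighbor set of $v$, $N(S)=\bigcup_{v\in S}N(v)$, $\deg(v)=|N(v)|$. The arboricity of $G$ is $\max_{U\subseteq V,|U|\ge 2}\lceil |E(U)|/(|U|-1)\rceil$, where $E(U)$ is the set of edges induced by $U$. -}

module Defs where

open import Data.Bool using (Bool; true; false; _∧_; _∨_; not; T)
open import Data.Nat as ℕ using (ℕ; zero; suc; _+_; _*_; _∸_; _^_; _≤_; _<_)
import Data.Nat.Properties as ℕP
open import Data.Fin using (Fin; toℕ)
open import Data.Fin.Subset using (Subset; ∣_∣; _∩_; _─_) renaming (⊥ to ∅)
open import Data.Vec using (Vec; tabulate; lookup)
open import Data.List as List using (List; []; _∷_; length; filter; map; allFin)
open import Data.Nat.ListAction using (sum)
open import Data.Bool.ListAction using (any)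
open import Data.Integer as ℤ using (ℤ; +_)
open import Data.Rational as ℚ using (ℚ; 0ℚ; ↥_; ↧ₙ_)
import Data.Rational.Properties as ℚP
open import Data.Product using (_×_)
open import Data.Sum using (_⊎_)
open import Relation.Nullary.Decidable using (⌊_⌋; T?; Dec; _⊎-dec_)

open import Relation.Binary.PropositionalEquality using (_≡_; _≢_)

record Graph (n : ℕ) : Set where
  field
    adj     : Fin n → Fin n → Bool
    adj-sym : ∀ u v → adj u v ≡ adj v u
    adj-irr : ∀ v → adj v v ≡ false
open Graph public

module _ {n : ℕ} (G : Graph n) where

  N : Fin n → Subset n
  N v = tabulate (λ u → adj G v u)

  NSet : Subset n → Subset n
  NSet S = tabulate (λ u → any (λ v → lookup S v ∧ adj G v u) (allFin n))

  deg : Fin n → ℕ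
  deg v = ∣ N v ∣

  edgesIn : Subset n → ℕ
  edgesIn U = sum (map (λ i → length (filter (λ j → T? (lookup U i ∧ lookup U j ∧ adj G i j))
                                           (filter (λ j → toℕ i ℕ.<? toℕ j) (allFin n))))
                       (allFin n))

  numEdges : ℕ
  numEdges = edgesIn (tabulate (λ _ → true))

  -- arboricity ≤ λ, i.e. ⌈|E(U)|/(|U|-1)⌉ ≤ λ for all U with |U| ≥ 2
  ArboricityAtMost : ℕ → Set
  ArboricityAtMost λ' = ∀ (U : Subset n) → 2 ≤ ∣ U ∣ → edgesIn U ≤ λ' * (∣ U ∣ ∸ 1)

-- Exact comparisons involving log₂ m (no reals in the library).
-- d · log₂ m ≤ c   ⇔   m ^ d ≤ 2 ^ c     (for m ≥ 1)
dLog₂≤ : (m c d : ℕ) → Set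
dLog₂≤ m c d = m ^ d ≤ 2 ^ c

-- With T = √(m · log₂ m · λ):
-- deg ≥ 20 T  ⇔  400 · m · λ · log₂ m ≤ deg²
AtLeast20T : (m λ' x : ℕ) → Set
AtLeast20T m λ' x = dLog₂≤ m (x * x) (400 * m * λ')

-- for p ∈ ℚ, k ≥ 1:  p ≤ m / (k · T).
-- If p ≤ 0 this holds; otherwise, writing p = a/b (a,b > 0),
-- a k T ≤ b m ⇔ a² k² m λ log₂ m ≤ b² m² ⇔ (a² k² λ) log₂ m ≤ b² m.
LeMOverKT : (m λ' k : ℕ) → ℚ → Set
LeMOverKT m λ' k p =
  (p ℚ.≤ 0ℚ) ⊎ dLog₂≤ m (b * b * m) (a * a * k * k * λ')
  where
    a = ℤ.∣ ↥ p ∣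
    b = ↧ₙ p

atLeast20T? : ∀ m λ' x → Dec (AtLeast20T m λ' x)
atLeast20T? m λ' x = ℕ._≤?_ _ _

leMOverKT? : ∀ m λ' k p → Dec (LeMOverKT m λ' k p)
leMOverKT? m λ' k p = (p ℚP.≤? 0ℚ) ⊎-dec (ℕ._≤?_ _ _)

IsMedian : ℚ → List ℚ → Set
IsMedian x S =
  (length S ≤ 2 * length (filter (λ y → y ℚP.≤? x) S)) ×
  (length S ≤ 2 * length (filter (λ y → x ℚP.≤? y) S))

-- a / d as a rational, with the (never used) convention a / 0 = 0
frac : ℕ → ℕ → ℚ
frac a zero    = 0ℚ
frac a (suc d) = (+ a) ℚ./ suc d

-- A median-choice rule: for iteration i and vertex v, picks a value for
-- the multiset S_i(v).  Valid if it always picks a median of a nonempty list.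
MedianChoice : ℕ → Set
MedianChoice n = ℕ → Fin n → List ℚ → ℚ

ValidMedianChoice : ∀ {n} → MedianChoice n → Set
ValidMedianChoice {n} med = ∀ i (v : Fin n) (S : List ℚ) → S ≢ [] → IsMedian (med i v S) S

module Stage1 {n : ℕ} (G : Graph n) (λ' : ℕ) (med : MedianChoice n) where

  m : ℕ
  m = numEdges G

  Vhigh : Subset n
  Vhigh = tabulate (λ v → ⌊ atLeast20T? m λ' (deg G v) ⌋)

  Astar : Subset n
  Astar = NSet G Vhigh ─ Vhigh

  unitcost : Subset n → Fin n → ℚ
  unitcost K u = frac (deg G u) ∣ N G u ∩ K ∣

  Smulti : Subset n → Fin n → List ℚ
  Smulti K v = map (unitcost K)
    (filter (λ u → T? (lookup (N G v ∩ Astar) u)) (allFin n))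

  p : ℕ → Subset n → Fin n → ℚ
  p i K v = med i v (Smulti K v)

  L : ℕ → Subset n → Subset n
  L i K = tabulate (λ v → lookup K v ∧ ⌊ leMOverKT? m λ' ∣ K ∣ (p i K v) ⌋)

  -- K after j iterations:  K-after j = K_{j+1};  K_1 = V*_high, K_{i+1} = K_i ∖ L_i
  K-after : ℕ → Subset n
  K-after zero    = Vhigh
  K-after (suc j) = K-after j ─ L (suc j) (K-after j)

module Submission where

-- Put t = ⌈log₂ m⌉ (so m ≤ 2^t ≤ m²) and R = t·m·λ, which lies between T²
-- and 2T².  Since T is irrational, every inequality involving T is kept in
-- squared form; summing such inequalities is done by 'sum-sq-compare', the
-- squared form of "√A·cᵢ ≤ √B·dᵢ for all i implies √A·Σc ≤ √B·Σd".
--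
--  * Few high vertices: each high vertex has deg² ≥ 200R, and Σ deg = 2m
--    (handshake), so h = |V*_high| satisfies 50h² ≤ m.  Consequently a high
--    vertex v has most of its neighbours in A*: s(v) = |N(v) ∩ A*| ≥ 8T.
--  * Halving: for K ⊆ V*_high with |K| = k, the survivors K' = K ∖ L satisfy
--    2|K'| ≤ k.  Count the pairs (v,u) with v ∈ K', u ∈ N(v) ∩ A* and
--    unitcost(u) ≥ p(v).  As p(v) is a median there are ≥ s(v)/2 ≥ 4T of
--    them for each v.  As p(v) > m/(kT), each such u has
--    |N(u) ∩ K| ≤ kT·deg(u)/m, so summing over u there are ≤ 2kT of them.
--  * Iterating, |K_{j+1}|·2^j ≤ h < m ≤ 2^t, so K_{t+1} is empty.

open import Defs
open import Data.Nat using (ℕ; _≤_)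
open import Data.Nat.Logarithm using (⌈log₂_⌉)
open import Data.Fin.Subset using (Subset) renaming (⊥ to ∅)
open import Relation.Binary.PropositionalEquality using (_≡_)

open import Data.Bool using (Bool; true; false; _∧_; not)
open import Data.Bool.Properties using (∧-zeroʳ; ∧-identityʳ; ∨-zeroʳ)
open import Data.Bool.ListAction using (any)
open import Data.Fin using (Fin; zero; suc; toℕ)
open import Data.Fin.Properties using (toℕ-injective)
open import Data.Fin.Subset using (∣_∣; _∩_; _─_)
import Data.Integer as ℤ
import Data.Integer.Properties as ℤP
open import Data.List as List using (List; filter; map; length; allFin)
open import Data.List.Membership.Propositional using (_∈_)
open import Data.List.Membership.Propositional.Properties using (∈-allFin)
open import Data.List.Properties using (length-map; map-∘; map-tabulate)
open import Data.List.Relation.Unary.Any using (here; there)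
open import Data.Nat
open import Data.Nat.Logarithm.Core using (⌈log2⌉)
open import Data.Nat.ListAction renaming (sum to listSum)
open import Data.Nat.Properties
open import Data.Nat.Tactic.RingSolver using (solve-∀)
open import Algebra.Properties.Semiring.Sum +-*-semiring
  using (sum; sum-cong-≗; ∑-distrib-+; ∑-comm; *-distribˡ-sum)
open import Data.Product using (_×_; _,_; proj₁; proj₂; ∃-syntax)
open import Data.Rational as ℚ using (ℚ; mkℚ; 0ℚ; ↥_; ↧ₙ_)
import Data.Rational.Properties as ℚP
open import Data.Rational.Unnormalised as ℚᵘ using (mkℚᵘ)
import Data.Rational.Unnormalised.Properties as ℚᵘP
open import Data.Sum using (inj₁; inj₂)
open import Data.Vec using ([]; _∷_; lookup; tabulate)
open import Data.Vec.Properties using (lookup∘tabulate; lookup-zipWith)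
open import Function using (_∘_)
open import Induction.WellFounded using (Acc; acc)
open import Relation.Nullary using (Dec; yes; no; does; ¬_; contradiction)
open import Relation.Nullary.Decidable using (⌊_⌋; T?; isYes≗does; dec-true; dec-false)
open import Relation.Binary.Definitions using (tri<; tri≈; tri>)
open import Relation.Binary.PropositionalEquality
  using (_≢_; ≢-sym; refl; sym; trans; cong; cong₂; subst; subst₂; module ≡-Reasoning)

sum-mono-≤ : ∀ {n} {f g : Fin n → ℕ} → (∀ i → f i ≤ g i) → sum f ≤ sum g
sum-mono-≤ {zero}  f≤g = z≤n
sum-mono-≤ {suc n} f≤g = +-mono-≤ (f≤g zero) (sum-mono-≤ (f≤g ∘ suc))

term≤sum : ∀ {n} (f : Fin n → ℕ) i → f i ≤ sum f
term≤sum f zero    = m≤m+n (f zero) _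
term≤sum f (suc i) = ≤-trans (term≤sum (f ∘ suc) i) (m≤n+m _ (f zero))

sum-pos⇒term-pos : ∀ {n} (f : Fin n → ℕ) → 0 < sum f → ∃[ i ] 0 < f i
sum-pos⇒term-pos {zero}  f ()
sum-pos⇒term-pos {suc n} f pos with f zero in f₀
... | suc _ = zero , subst (0 <_) (sym f₀) z<s
... | zero  = let i , fᵢ>0 = sum-pos⇒term-pos (f ∘ suc) pos in suc i , fᵢ>0

listSum-allFin : ∀ {n} (f : Fin n → ℕ) → listSum (map f (allFin n)) ≡ sum f
listSum-allFin f = trans (cong listSum (map-tabulate (λ i → i) f)) (listSum-tabulate f)
  where
  listSum-tabulate : ∀ {n} (g : Fin n → ℕ) → listSum (List.tabulate g) ≡ sum g
  listSum-tabulate {zero}  g = refl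
  listSum-tabulate {suc n} g = cong (g zero +_) (listSum-tabulate (g ∘ suc))

square-cancel : ∀ {x y} → x * x ≤ y * y → x ≤ y
square-cancel {x} {y} x²≤y² with x ≤? y
... | yes x≤y = x≤y
... | no  x≰y = contradiction x²≤y² (<⇒≱ (*-mono-< (≰⇒> x≰y) (≰⇒> x≰y)))

-- Summation in squared form: if A·cᵢ² ≤ B·dᵢ² for all i, then A·(Σc)² ≤ B·(Σd)².
-- (Expand both squares; the cross terms compare because their squares do.)
sum-sq-compare : ∀ {n} A B (c d : Fin n → ℕ) → (∀ i → A * (c i * c i) ≤ B * (d i * d i)) →
                 A * (sum c * sum c) ≤ B * (sum d * sum d)
sum-sq-compare {zero}  A B c d _ = ≤-trans (≤-reflexive (*-zeroʳ A)) z≤n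
sum-sq-compare {suc n} A B c d cmp =
  subst₂ _≤_ (sym (expand A c₀ C)) (sym (expand B d₀ D))
    (+-mono-≤ (+-mono-≤ (cmp zero) (*-monoʳ-≤ 2 cross)) rest)
  where
  c₀ = c zero
  d₀ = d zero
  C = sum (c ∘ suc)
  D = sum (d ∘ suc)
  rest : A * (C * C) ≤ B * (D * D)
  rest = sum-sq-compare A B (c ∘ suc) (d ∘ suc) (cmp ∘ suc)
  regroup : ∀ A x y → (A * x * y) * (A * x * y) ≡ (A * (x * x)) * (A * (y * y))
  regroup = solve-∀
  expand : ∀ A x y → A * ((x + y) * (x + y)) ≡ A * (x * x) + 2 * (A * x * y) + A * (y * y)
  expand = solve-∀
  cross : A * c₀ * C ≤ B * d₀ * D
  cross = square-cancel (subst₂ _≤_ (sym (regroup A c₀ C)) (sym (regroup B d₀ D))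
                                    (*-mono-≤ (cmp zero) rest))

𝟙 : Bool → ℕ
𝟙 true  = 1
𝟙 false = 0

𝟙≤1 : ∀ b → 𝟙 b ≤ 1
𝟙≤1 true  = ≤-refl
𝟙≤1 false = z≤n

𝟙-∧ : ∀ a b → 𝟙 (a ∧ b) ≡ 𝟙 a * 𝟙 b
𝟙-∧ true  b = sym (*-identityˡ (𝟙 b))
𝟙-∧ false b = refl

𝟙-mono : ∀ {a b} → (a ≡ true → b ≡ true) → 𝟙 a ≤ 𝟙 b
𝟙-mono {false} _   = z≤n
𝟙-mono {true}  a⇒b rewrite a⇒b refl = ≤-refl

𝟙-pos : ∀ {b} → 0 < 𝟙 b → b ≡ true
𝟙-pos {true} _ = refl

𝟙*≤ : ∀ b x → 𝟙 b * x ≤ x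
𝟙*≤ b x = ≤-trans (*-monoˡ-≤ x (𝟙≤1 b)) (≤-reflexive (*-identityˡ x))

∧-elim : ∀ a b → a ∧ b ≡ true → a ≡ true × b ≡ true
∧-elim true b b≡true = refl , b≡true

𝟙-cases : ∀ {a b} c → (a ≡ true → c ≡ false → b ≡ true) → 𝟙 a ≤ 𝟙 b + 𝟙 c
𝟙-cases {a} {b} true  _    = ≤-trans (𝟙≤1 a) (m≤n+m 1 (𝟙 b))
𝟙-cases {a} {b} false a⇒b = ≤-trans (𝟙-mono (λ a≡true → a⇒b a≡true refl)) (m≤m+n (𝟙 b) 0)

∧-not-elim : ∀ a b → a ∧ not (a ∧ b) ≡ true → a ≡ true × b ≡ false
∧-not-elim true false _ = refl , refl

true⇒witness : ∀ {P : Set} (P? : Dec P) → does P? ≡ true → P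
true⇒witness (yes p) _ = p

false⇒refutation : ∀ {P : Set} (P? : Dec P) → does P? ≡ false → ¬ P
false⇒refutation (no ¬p) _ = ¬p

𝟙-guard : ∀ b {x y} → (b ≡ true → x ≤ y) → 𝟙 b * x ≤ 𝟙 b * y
𝟙-guard false _   = z≤n
𝟙-guard true  x≤y = *-monoʳ-≤ 1 (x≤y refl)

count-sq-bound : ∀ {n} (b : Fin n → Bool) A (d : Fin n → ℕ) → (∀ i → b i ≡ true → A ≤ d i * d i) →
                 A * (sum (𝟙 ∘ b) * sum (𝟙 ∘ b)) ≤ sum (λ i → 𝟙 (b i) * d i) * sum (λ i → 𝟙 (b i) * d i)
count-sq-bound b A d bound =
  ≤-trans (sum-sq-compare A 1 (𝟙 ∘ b) (λ i → 𝟙 (b i) * d i) pointwise) (≤-reflexive (*-identityˡ _))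
  where
  pointwise : ∀ i → A * (𝟙 (b i) * 𝟙 (b i)) ≤ 1 * ((𝟙 (b i) * d i) * (𝟙 (b i) * d i))
  pointwise i with b i | bound i
  ... | false | _      = ≤-reflexive (*-zeroʳ A)
  ... | true  | A≤d²ᵢ  = subst₂ _≤_ (sym (*-identityʳ A)) (sym (1·1·d² (d i))) (A≤d²ᵢ refl)
    where
    1·1·d² : ∀ x → 1 * ((1 * x) * (1 * x)) ≡ x * x
    1·1·d² = solve-∀

∣∣≡sum : ∀ {n} (S : Subset n) → ∣ S ∣ ≡ sum (𝟙 ∘ lookup S)
∣∣≡sum []          = refl
∣∣≡sum (true  ∷ S) = cong suc (∣∣≡sum S)
∣∣≡sum (false ∷ S) = ∣∣≡sum S

∣∣≡0⇒∅ : ∀ {n} (S : Subset n) → ∣ S ∣ ≡ 0 → S ≡ ∅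
∣∣≡0⇒∅ []          _     = refl
∣∣≡0⇒∅ (false ∷ S) ∣S∣≡0 = cong (false ∷_) (∣∣≡0⇒∅ S ∣S∣≡0)

-- The full subset, written as in the definition of numEdges.
∣full∣≡n : ∀ n → ∣ tabulate {n = n} (λ _ → true) ∣ ≡ n
∣full∣≡n zero    = refl
∣full∣≡n (suc n) = cong suc (∣full∣≡n n)

lookup-∩ : ∀ {n} (P Q : Subset n) v → lookup (P ∩ Q) v ≡ lookup P v ∧ lookup Q v
lookup-∩ P Q v = lookup-zipWith _∧_ v P Q

lookup-─ : ∀ {n} (P Q : Subset n) v → lookup (P ─ Q) v ≡ lookup P v ∧ not (lookup Q v)
lookup-─ (x ∷ P) (true  ∷ Q) zero    = sym (∧-zeroʳ x)
lookup-─ (x ∷ P) (false ∷ Q) zero    = sym (∧-identityʳ x)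
lookup-─ (x ∷ P) (_     ∷ Q) (suc v) = lookup-─ P Q v

any-witness : ∀ {A : Set} (f : A → Bool) {x} {xs : List A} → x ∈ xs → f x ≡ true → any f xs ≡ true
any-witness f (here refl) fx rewrite fx = refl
any-witness f {xs = y List.∷ _} (there x∈xs) fx rewrite any-witness f x∈xs fx = ∨-zeroʳ (f y)

module _ {A : Set} {P : A → Set} (P? : ∀ x → Dec (P x)) where

  length-filter≡ : ∀ xs → length (filter P? xs) ≡ listSum (map (𝟙 ∘ does ∘ P?) xs)
  length-filter≡ List.[] = refl
  length-filter≡ (x List.∷ xs) with does (P? x)
  ... | true  = cong suc (length-filter≡ xs)
  ... | false = length-filter≡ xs

  listSum-filter : ∀ (f : A → ℕ) xs →
                   listSum (map f (filter P? xs)) ≡ listSum (map (λ x → 𝟙 (does (P? x)) * f x) xs)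
  listSum-filter f List.[] = refl
  listSum-filter f (x List.∷ xs) with does (P? x)
  ... | true  = cong₂ _+_ (sym (+-identityʳ (f x))) (listSum-filter f xs)
  ... | false = listSum-filter f xs

module _ {n : ℕ} (G : Graph n) where

  deg≡sum : ∀ v → deg G v ≡ sum (λ u → 𝟙 (adj G v u))
  deg≡sum v = trans (∣∣≡sum (N G v)) (sum-cong-≗ (λ u → cong 𝟙 (lookup∘tabulate (adj G v) u)))

  -- 𝟙[i < j]: an edge {i,j} is recorded in numEdges from its smaller endpoint.
  before : Fin n → Fin n → ℕ
  before i j = 𝟙 (does (toℕ i <? toℕ j))

  numEdges≡sum : numEdges G ≡ sum (λ i → sum (λ j → before i j * 𝟙 (adj G i j)))
  numEdges≡sum = trans (listSum-allFin edges-from) (sum-cong-≗ edges-from≡sum)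
    where
    full = tabulate {n = n} (λ _ → true)
    edge? : Fin n → Fin n → Bool
    edge? i j = lookup full i ∧ lookup full j ∧ adj G i j
    edges-from : Fin n → ℕ
    edges-from i = length (filter (λ j → T? (edge? i j)) (filter (λ j → toℕ i <? toℕ j) (allFin n)))
    edge?≡adj : ∀ i j → edge? i j ≡ adj G i j
    edge?≡adj i j rewrite lookup∘tabulate {n = n} (λ _ → true) i
                        | lookup∘tabulate {n = n} (λ _ → true) j = refl
    edges-from≡sum : ∀ i → edges-from i ≡ sum (λ j → before i j * 𝟙 (adj G i j))
    edges-from≡sum i =
      trans (length-filter≡ (λ j → T? (edge? i j)) (filter (λ j → toℕ i <? toℕ j) (allFin n)))
      (trans (listSum-filter (λ j → toℕ i <? toℕ j) (λ j → 𝟙 (edge? i j)) (allFin n))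
      (trans (listSum-allFin (λ j → before i j * 𝟙 (edge? i j)))
             (sum-cong-≗ (λ j → cong (λ b → before i j * 𝟙 b) (edge?≡adj i j)))))

  before-< : ∀ {i j} → toℕ i < toℕ j → before i j ≡ 1
  before-< {i} {j} i<j = cong 𝟙 (dec-true (toℕ i <? toℕ j) i<j)

  before-≮ : ∀ {i j} → toℕ i ≮ toℕ j → before i j ≡ 0
  before-≮ {i} {j} i≮j = cong 𝟙 (dec-false (toℕ i <? toℕ j) i≮j)

  adj-split : ∀ i j → 𝟙 (adj G i j) ≡ before i j * 𝟙 (adj G i j) + before j i * 𝟙 (adj G j i)
  adj-split i j with <-cmp (toℕ i) (toℕ j)
  ... | tri< i<j _ j≮i rewrite before-< i<j | before-≮ j≮i = sym (trans (+-identityʳ _) (+-identityʳ _))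
  ... | tri> i≮j _ j<i rewrite before-≮ i≮j | before-< j<i | adj-sym G i j = sym (+-identityʳ _)
  ... | tri≈ i≮j i≡j _ rewrite before-≮ i≮j | toℕ-injective i≡j | adj-irr G j = sym (*-zeroʳ (before j j))

  handshake : sum (deg G) ≡ 2 * numEdges G
  handshake = begin
      sum (deg G)
    ≡⟨ sum-cong-≗ (λ i → trans (deg≡sum i) (sum-cong-≗ (adj-split i))) ⟩
      sum (λ i → sum (λ j → forward i j + forward j i))
    ≡⟨ sum-cong-≗ (λ i → ∑-distrib-+ (forward i) (λ j → forward j i)) ⟩
      sum (λ i → sum (forward i) + sum (λ j → forward j i))
    ≡⟨ ∑-distrib-+ (λ i → sum (forward i)) (λ i → sum (λ j → forward j i)) ⟩
      E + sum (λ i → sum (λ j → forward j i))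
    ≡⟨ cong (E +_) (∑-comm (λ i j → forward j i)) ⟩
      E + E
    ≡⟨ cong₂ _+_ (sym numEdges≡sum) (trans (sym numEdges≡sum) (sym (+-identityʳ _))) ⟩
      2 * numEdges G ∎
    where
    open ≡-Reasoning
    forward : Fin n → Fin n → ℕ
    forward i j = before i j * 𝟙 (adj G i j)
    E = sum (λ i → sum (forward i))

-- A graph with an edge has at least two vertices (on fewer, numEdges computes to 0).
vertices≥2 : ∀ {n} (G : Graph n) → 2 ≤ numEdges G → 2 ≤ n
vertices≥2 {suc (suc _)} G _ = s≤s (s≤s z≤n)
vertices≥2 {suc zero}    G ()
vertices≥2 {zero}        G ()

-- A graph with at least two edges has arboricity at least 1
-- (apply the bound to U = V).
arboricity≥1 : ∀ {n} (G : Graph n) {λ'} → 2 ≤ numEdges G → ArboricityAtMost G λ' → 1 ≤ λ'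
arboricity≥1 G {suc _} _ _ = s≤s z≤n
arboricity≥1 {n} G {zero} m≥2 arb
  with ≤-trans m≥2 (arb full (subst (2 ≤_) (sym (∣full∣≡n n)) (vertices≥2 G m≥2)))
  where full = tabulate {n = n} (λ _ → true)
... | ()

n≤2⌈n/2⌉ : ∀ n → n ≤ 2 * ⌈ n /2⌉
n≤2⌈n/2⌉ zero          = z≤n
n≤2⌈n/2⌉ (suc zero)    = s≤s z≤n
n≤2⌈n/2⌉ (suc (suc n)) = subst (suc (suc n) ≤_) (sym (*-suc 2 ⌈ n /2⌉)) (s≤s (s≤s (n≤2⌈n/2⌉ n)))

2⌈n/2⌉≤1+n : ∀ n → 2 * ⌈ n /2⌉ ≤ suc n
2⌈n/2⌉≤1+n zero          = z≤n
2⌈n/2⌉≤1+n (suc zero)    = ≤-refl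
2⌈n/2⌉≤1+n (suc (suc n)) = subst (_≤ suc (suc (suc n))) (sym (*-suc 2 ⌈ n /2⌉)) (s≤s (s≤s (2⌈n/2⌉≤1+n n)))

-- n ≤ 2^⌈log₂ n⌉ < 2n (the latter as 2^⌈log₂ n⌉ + 2 ≤ 2n for n ≥ 2), by well-founded
-- recursion along the definition ⌈log2⌉ (2+k) = 1 + ⌈log2⌉ ⌈(2+k)/2⌉.
⌈log2⌉-bounds : ∀ n (rec : Acc _<_ n) →
                n ≤ 2 ^ ⌈log2⌉ n rec × (2 ≤ n → 2 ^ ⌈log2⌉ n rec + 2 ≤ 2 * n)
⌈log2⌉-bounds zero                 _        = z≤n , λ ()
⌈log2⌉-bounds (suc zero)           _        = s≤s z≤n , λ { (s≤s ()) }
⌈log2⌉-bounds (suc (suc zero))     (acc _)  = ≤-refl , λ _ → ≤-refl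
⌈log2⌉-bounds (suc (suc k@(suc _))) (acc rs) = upper , λ _ → lower
  where
  half = ⌈ suc (suc k) /2⌉
  t' = ⌈log2⌉ half (rs (⌈n/2⌉<n k))
  ih = ⌈log2⌉-bounds half (rs (⌈n/2⌉<n k))
  upper : suc (suc k) ≤ 2 * 2 ^ t'
  upper = ≤-trans (n≤2⌈n/2⌉ (suc (suc k))) (*-monoʳ-≤ 2 (proj₁ ih))
  2^t'≤1+k : 2 ^ t' ≤ suc k
  2^t'≤1+k = s≤s⁻¹ (s≤s⁻¹ (subst (_≤ suc (suc (suc k))) (+-comm (2 ^ t') 2)
               (≤-trans (proj₂ ih (s≤s (s≤s z≤n))) (2⌈n/2⌉≤1+n (suc (suc k))))))
  lower : 2 * 2 ^ t' + 2 ≤ 2 * suc (suc k)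
  lower = ≤-trans (+-monoˡ-≤ 2 (*-monoʳ-≤ 2 2^t'≤1+k)) (≤-reflexive (double k))
    where
    double : ∀ x → 2 * suc x + 2 ≡ 2 * suc (suc x)
    double = solve-∀

n≤2^⌈log₂n⌉ : ∀ n → n ≤ 2 ^ ⌈log₂ n ⌉
n≤2^⌈log₂n⌉ n = proj₁ (⌈log2⌉-bounds n _)

2^⌈log₂n⌉≤n² : ∀ n → 2 ≤ n → 2 ^ ⌈log₂ n ⌉ ≤ n * n
2^⌈log₂n⌉≤n² n n≥2 = ≤-trans (m≤m+n _ 2) (≤-trans (proj₂ (⌈log2⌉-bounds n _) n≥2) (*-monoˡ-≤ n n≥2))

2^-cancel : ∀ {a b} → 2 ^ a ≤ 2 ^ b → a ≤ b
2^-cancel {a} {b} 2^a≤2^b with a ≤? b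
... | yes a≤b = a≤b
... | no  a≰b = contradiction 2^a≤2^b (<⇒≱ (^-monoʳ-< 2 (s≤s (s≤s z≤n)) (≰⇒> a≰b)))

^-distribʳ-* : ∀ a b e → (a * b) ^ e ≡ a ^ e * b ^ e
^-distribʳ-* a b zero    = refl
^-distribʳ-* a b (suc e) = trans (cong (a * b *_) (^-distribʳ-* a b e)) (interchange a b (a ^ e) (b ^ e))
  where
  interchange : ∀ a b x y → a * b * (x * y) ≡ a * x * (b * y)
  interchange = solve-∀

dLog₂≤⇒ : ∀ {m t} d c → 2 ^ t ≤ m * m → dLog₂≤ m c d → t * d ≤ 2 * c
dLog₂≤⇒ {m} {t} d c 2^t≤m² m^d≤2^c =
  subst (t * d ≤_) (cong (c +_) (sym (+-identityʳ c))) (2^-cancel (begin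
    2 ^ (t * d)     ≡⟨ ^-*-assoc 2 t d ⟨
    (2 ^ t) ^ d     ≤⟨ ^-monoˡ-≤ d 2^t≤m² ⟩
    (m * m) ^ d     ≡⟨ ^-distribʳ-* m m d ⟩
    m ^ d * m ^ d   ≤⟨ *-mono-≤ m^d≤2^c m^d≤2^c ⟩
    2 ^ c * 2 ^ c   ≡⟨ ^-distribˡ-+-* 2 c c ⟨
    2 ^ (c + c)     ∎))
  where open ≤-Reasoning

¬dLog₂≤⇒ : ∀ {m t} d c → m ≤ 2 ^ t → ¬ dLog₂≤ m c d → c ≤ t * d
¬dLog₂≤⇒ {m} {t} d c m≤2^t fails with c ≤? t * d
... | yes c≤td = c≤td
... | no  c≰td = contradiction m^d≤2^c fails
  where
  m^d≤2^c : m ^ d ≤ 2 ^ c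
  m^d≤2^c = ≤-trans (^-monoˡ-≤ d m≤2^t)
              (≤-trans (≤-reflexive (^-*-assoc 2 t d)) (^-monoʳ-≤ 2 (<⇒≤ (≰⇒> c≰td))))

≤frac⇒cross : ∀ (p : ℚ) d c → ¬ (p ℚ.≤ 0ℚ) → p ℚ.≤ frac d (suc c) → ℤ.∣ ↥ p ∣ * suc c ≤ d * ↧ₙ p
≤frac⇒cross (mkℚ (ℤ.-[1+ _ ]) _ _) d c p≰0 _ = contradiction (ℚ.*≤* ℤ.-≤+) p≰0
≤frac⇒cross p@(mkℚ (ℤ.+ a) b _) d c _ p≤d/c
  with ℚᵘP.≤-respʳ-≃ (ℚP.toℚᵘ-fromℚᵘ (mkℚᵘ (ℤ.+ d) c)) (ℚP.toℚᵘ-mono-≤ p≤d/c)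
... | ℚᵘ.*≤* ac≤db = ℤP.drop‿+≤+ (subst₂ ℤ._≤_ (sym (ℤP.pos-* a (suc c))) (sym (ℤP.pos-* d (suc b))) ac≤db)

cross-sq : ∀ {m t k λ'} a b c d → 1 ≤ b → a * c ≤ d * b → b * b * m ≤ t * (a * a * k * k * λ') →
           m * (c * c) ≤ t * (k * k * λ') * (d * d)
cross-sq {m} {t} {k} {λ'} a b@(suc _) c d _ ac≤db b²m≤ta²k²λ = *-cancelˡ-≤ (b * b) (begin
    b * b * (m * (c * c))                    ≡⟨ regroup₁ b m c ⟩
    (b * b * m) * (c * c)                    ≤⟨ *-monoˡ-≤ (c * c) b²m≤ta²k²λ ⟩
    t * (a * a * k * k * λ') * (c * c)       ≡⟨ regroup₂ t a k λ' c ⟩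
    t * (k * k * λ') * ((a * c) * (a * c))   ≤⟨ *-monoʳ-≤ (t * (k * k * λ')) (*-mono-≤ ac≤db ac≤db) ⟩
    t * (k * k * λ') * ((d * b) * (d * b))   ≡⟨ regroup₃ t k λ' d b ⟩
    b * b * (t * (k * k * λ') * (d * d))     ∎)
  where
  open ≤-Reasoning
  regroup₁ : ∀ b m c → b * b * (m * (c * c)) ≡ (b * b * m) * (c * c)
  regroup₁ = solve-∀
  regroup₂ : ∀ t a k λ' c → t * (a * a * k * k * λ') * (c * c) ≡ t * (k * k * λ') * ((a * c) * (a * c))
  regroup₂ = solve-∀
  regroup₃ : ∀ t k λ' d b → t * (k * k * λ') * ((d * b) * (d * b)) ≡ b * b * (t * (k * k * λ') * (d * d))
  regroup₃ = solve-∀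

-- Failing the test p ≤ m/(k·T) (T² = m·log₂ m·λ) while p ≤ d/c means c/d < k·T/m;
-- in squared form  m·c² ≤ t·k²λ·d²  for any t with m ≤ 2^t.
above-threshold : ∀ {m t λ' k} (p : ℚ) c d → 1 ≤ c → m ≤ 2 ^ t → ¬ LeMOverKT m λ' k p →
                  p ℚ.≤ frac d c → m * (c * c) ≤ t * (k * k * λ') * (d * d)
above-threshold {m} {t} {λ'} {k} p@(mkℚ num b _) (suc c) d _ m≤2^t fails p≤d/c =
  cross-sq {m} {t} {k} {λ'} (ℤ.∣ num ∣) (suc b) (suc c) d (s≤s z≤n)
    (≤frac⇒cross p d c (fails ∘ inj₁) p≤d/c)
    (¬dLog₂≤⇒ {m} {t} (ℤ.∣ num ∣ * ℤ.∣ num ∣ * k * k * λ') (suc b * suc b * m) m≤2^t (fails ∘ inj₂))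

most-neighbours-remain : ∀ {R} d s h → d ≤ s + h → 9 * (h * h) ≤ d * d → 200 * R ≤ d * d →
                         64 * R ≤ s * s
most-neighbours-remain {R} d s h d≤s+h 9h²≤d² 200R≤d² = *-cancelˡ-≤ 9 (begin
    9 * (64 * R)     ≡⟨ *-assoc 9 64 R ⟨
    576 * R          ≤⟨ *-monoˡ-≤ R (m≤m+n 576 224) ⟩
    800 * R          ≡⟨ *-assoc 4 200 R ⟩
    4 * (200 * R)    ≤⟨ *-monoʳ-≤ 4 200R≤d² ⟩
    4 * (d * d)      ≡⟨ square-2 d ⟩
    (2 * d) * (2 * d) ≤⟨ *-mono-≤ 2d≤3s 2d≤3s ⟩
    (3 * s) * (3 * s) ≡⟨ square-3 s ⟨
    9 * (s * s)      ∎)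
  where
  open ≤-Reasoning
  square-2 : ∀ x → 4 * (x * x) ≡ (2 * x) * (2 * x)
  square-2 = solve-∀
  square-3 : ∀ x → 9 * (x * x) ≡ (3 * x) * (3 * x)
  square-3 = solve-∀
  3h≤d : 3 * h ≤ d
  3h≤d = square-cancel (subst (_≤ d * d) (square-3 h) 9h²≤d²)
  2d≤3s : 2 * d ≤ 3 * s
  2d≤3s = +-cancelʳ-≤ d (2 * d) (3 * s) (begin
    2 * d + d         ≡⟨ +-comm (2 * d) d ⟩
    3 * d             ≤⟨ *-monoʳ-≤ 3 d≤s+h ⟩
    3 * (s + h)       ≡⟨ *-distribˡ-+ 3 s h ⟩
    3 * s + 3 * h     ≤⟨ +-monoʳ-≤ (3 * s) 3h≤d ⟩
    3 * s + d         ∎)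

halving-arith : ∀ m t λ' k X S Π → 1 ≤ m → 1 ≤ t → 1 ≤ λ' →
                64 * (t * m * λ') * (X * X) ≤ S * S → S ≤ 2 * Π →
                m * (Π * Π) ≤ t * (k * k * λ') * ((2 * m) * (2 * m)) → 2 * X ≤ k
halving-arith m@(suc _) t@(suc _) λ'@(suc _) k X S Π _ _ _ lower S≤2Π upper =
  square-cancel (*-cancelˡ-≤ (16 * (t * m * λ')) (begin
    16 * (t * m * λ') * ((2 * X) * (2 * X)) ≡⟨ regroup₁ t m λ' X ⟩
    64 * (t * m * λ') * (X * X)             ≤⟨ lower ⟩
    S * S                                    ≤⟨ *-mono-≤ S≤2Π S≤2Π ⟩
    (2 * Π) * (2 * Π)                        ≡⟨ regroup₂ Π ⟩
    4 * (Π * Π)                              ≤⟨ *-monoʳ-≤ 4 Π²≤ ⟩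
    4 * (4 * t * (k * k) * λ' * m)           ≡⟨ regroup₃ t k λ' m ⟩
    16 * (t * m * λ') * (k * k)              ∎))
  where
  open ≤-Reasoning
  regroup₁ : ∀ t m λ' X → 16 * (t * m * λ') * ((2 * X) * (2 * X)) ≡ 64 * (t * m * λ') * (X * X)
  regroup₁ = solve-∀
  regroup₂ : ∀ Π → (2 * Π) * (2 * Π) ≡ 4 * (Π * Π)
  regroup₂ = solve-∀
  regroup₃ : ∀ t k λ' m → 4 * (4 * t * (k * k) * λ' * m) ≡ 16 * (t * m * λ') * (k * k)
  regroup₃ = solve-∀
  regroup₄ : ∀ t k λ' m → t * (k * k * λ') * ((2 * m) * (2 * m)) ≡ m * (4 * t * (k * k) * λ' * m)
  regroup₄ = solve-∀
  Π²≤ : Π * Π ≤ 4 * t * (k * k) * λ' * m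
  Π²≤ = *-cancelˡ-≤ m (subst (m * (Π * Π) ≤_) (regroup₄ t k λ' m) upper)

h<m-arith : ∀ {h m} → 1 ≤ m → 50 * (h * h) ≤ m → h < m
h<m-arith {h} {m} m≥1 50h²≤m with m ≤? h
... | no  m≰h = ≰⇒> m≰h
... | yes m≤h = contradiction 50h²≤m (<⇒≱ (begin-strict
    m                 ≤⟨ m≤h ⟩
    h                 ≤⟨ m≤m*n h h ⟩
    h * h             <⟨ m<m*n (h * h) 50 (s≤s (s≤s z≤n)) ⟩
    h * h * 50        ≡⟨ *-comm (h * h) 50 ⟩
    50 * (h * h)      ∎))
  where
  open ≤-Reasoning
  instance
    h≢0 : NonZero h
    h≢0 = >-nonZero (≤-trans m≥1 m≤h)
    h²≢0 : NonZero (h * h)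
    h²≢0 = m*n≢0 h h

sq-bound-when-pos : ∀ A B {x c} → x ≤ c → (0 < x → A * (c * c) ≤ B) → A * (x * x) ≤ B
sq-bound-when-pos A B {zero}  _   _     = ≤-trans (≤-reflexive (*-zeroʳ A)) z≤n
sq-bound-when-pos A B {suc x} x≤c bound = ≤-trans (*-monoʳ-≤ A (*-mono-≤ x≤c x≤c)) (bound z<s)

multiple-below : ∀ {x P H} → x * P ≤ H → H < P → x ≡ 0
multiple-below {zero}  _      _   = refl
multiple-below {suc x} {P} xP≤H H<P = contradiction (≤-trans (m≤m+n P (x * P)) xP≤H) (<⇒≱ H<P)

module Analysis {n : ℕ} (G : Graph n) (λ' : ℕ) (med : MedianChoice n)
                (m≥2 : 2 ≤ numEdges G) (arb : ArboricityAtMost G λ')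
                (median : ValidMedianChoice med) where

  open Stage1 G λ' med

  t : ℕ
  t = ⌈log₂ m ⌉

  m≤2^t : m ≤ 2 ^ t
  m≤2^t = n≤2^⌈log₂n⌉ m

  2^t≤m² : 2 ^ t ≤ m * m
  2^t≤m² = 2^⌈log₂n⌉≤n² m m≥2

  m≥1 : 1 ≤ m
  m≥1 = ≤-trans (s≤s z≤n) m≥2

  t≥1 : 1 ≤ t
  t≥1 with t | m≤2^t
  ... | zero  | m≤1 = contradiction (≤-trans m≥2 m≤1) λ { (s≤s ()) }
  ... | suc _ | _   = s≤s z≤n

  λ≥1 : 1 ≤ λ'
  λ≥1 = arboricity≥1 G m≥2 arb

  instance
    m≢0 : NonZero m
    m≢0 = >-nonZero m≥1
    t≢0 : NonZero t
    t≢0 = >-nonZero t≥1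
    λ≢0 : NonZero λ'
    λ≢0 = >-nonZero λ≥1

  -- R = t·m·λ stands for T² = m·log₂ m·λ  (T² ≤ R ≤ 2T²).
  R : ℕ
  R = t * m * λ'

  m≤R : m ≤ R
  m≤R = ≤-trans (m≤n*m m t) (m≤m*n (t * m) λ')

  high : Fin n → Bool
  high v = lookup Vhigh v

  h : ℕ
  h = ∣ Vhigh ∣

  -- deg(v) ≥ 20T in squared form; the factor 2 is lost to t ≤ 2·log₂ m.
  high⇒deg² : ∀ v → high v ≡ true → 200 * R ≤ deg G v * deg G v
  high⇒deg² v v-high = *-cancelˡ-≤ 2 (subst (_≤ 2 * (d * d)) (regroup t m λ')
                         (dLog₂≤⇒ {m} {t} (400 * m * λ') (d * d) 2^t≤m² passes))
    where
    d = deg G v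
    passes : AtLeast20T m λ' d
    passes = true⇒witness (atLeast20T? m λ' d)
               (trans (sym (trans (lookup∘tabulate (λ w → ⌊ atLeast20T? m λ' (deg G w) ⌋) v)
                                  (isYes≗does (atLeast20T? m λ' d))))
                      v-high)
    regroup : ∀ t m λ' → t * (400 * m * λ') ≡ 2 * (200 * (t * m * λ'))
    regroup = solve-∀

  -- Few high vertices: 200·m·h² ≤ (Σ_{v high} deg v)² ≤ (2m)².
  few-high : 50 * (h * h) ≤ m
  few-high = *-cancelˡ-≤ (4 * m) {{m*n≢0 4 m}} (begin
      4 * m * (50 * (h * h))     ≡⟨ regroup₁ m h ⟩
      200 * m * (h * h)          ≡⟨ cong (λ x → 200 * m * (x * x)) (∣∣≡sum Vhigh) ⟩
      200 * m * (H * H)          ≤⟨ count-sq-bound high (200 * m) (deg G) high⇒200m≤deg² ⟩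
      D * D                      ≤⟨ *-mono-≤ D≤2m D≤2m ⟩
      (2 * m) * (2 * m)          ≡⟨ regroup₂ m ⟩
      4 * m * m                  ∎)
    where
    open ≤-Reasoning
    H = sum (𝟙 ∘ high)
    D = sum (λ v → 𝟙 (high v) * deg G v)
    high⇒200m≤deg² : ∀ v → high v ≡ true → 200 * m ≤ deg G v * deg G v
    high⇒200m≤deg² v v-high = ≤-trans (*-monoʳ-≤ 200 m≤R) (high⇒deg² v v-high)
    D≤2m : D ≤ 2 * m
    D≤2m = ≤-trans (sum-mono-≤ (λ v → 𝟙*≤ (high v) (deg G v))) (≤-reflexive (handshake G))
    regroup₁ : ∀ m h → 4 * m * (50 * (h * h)) ≡ 200 * m * (h * h)
    regroup₁ = solve-∀
    regroup₂ : ∀ m → (2 * m) * (2 * m) ≡ 4 * m * m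
    regroup₂ = solve-∀

  h<m : h < m
  h<m = h<m-arith m≥1 few-high

  inNA : Fin n → Fin n → Bool
  inNA v u = lookup (N G v ∩ Astar) u

  inNA≡ : ∀ v u → inNA v u ≡ adj G v u ∧ (lookup (NSet G Vhigh) u ∧ not (high u))
  inNA≡ v u = trans (lookup-∩ (N G v) Astar u)
                    (cong₂ _∧_ (lookup∘tabulate (adj G v) u) (lookup-─ (NSet G Vhigh) Vhigh u))

  s : Fin n → ℕ
  s v = sum (𝟙 ∘ inNA v)

  high-neighbour : ∀ {v u} → high v ≡ true → adj G v u ≡ true → high u ≡ false → inNA v u ≡ true
  high-neighbour {v} {u} v-high vu u-low = trans (inNA≡ v u)
    (trans (cong₂ (λ a b → a ∧ (b ∧ not (high u))) vu u∈N[Vhigh]) (cong not u-low))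
    where
    u∈N[Vhigh] : lookup (NSet G Vhigh) u ≡ true
    u∈N[Vhigh] = trans (lookup∘tabulate _ u)
                       (any-witness (λ w → high w ∧ adj G w u) (∈-allFin v) (cong₂ _∧_ v-high vu))

  deg≤s+h : ∀ v → high v ≡ true → deg G v ≤ s v + h
  deg≤s+h v v-high = begin
      deg G v                               ≡⟨ deg≡sum G v ⟩
      sum (λ u → 𝟙 (adj G v u))             ≤⟨ sum-mono-≤ split ⟩
      sum (λ u → 𝟙 (inNA v u) + 𝟙 (high u)) ≡⟨ ∑-distrib-+ (𝟙 ∘ inNA v) (𝟙 ∘ high) ⟩
      s v + sum (𝟙 ∘ high)                  ≡⟨ cong (s v +_) (∣∣≡sum Vhigh) ⟨
      s v + h                               ∎
    where
    open ≤-Reasoning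
    split : ∀ u → 𝟙 (adj G v u) ≤ 𝟙 (inNA v u) + 𝟙 (high u)
    split u = 𝟙-cases (high u) (λ vu u-low → high-neighbour v-high vu u-low)

  high⇒s² : ∀ v → high v ≡ true → 64 * R ≤ s v * s v
  high⇒s² v v-high = most-neighbours-remain {R} (deg G v) (s v) h (deg≤s+h v v-high) 9h²≤deg² (high⇒deg² v v-high)
    where
    9h²≤deg² : 9 * (h * h) ≤ deg G v * deg G v
    9h²≤deg² = ≤-trans (*-monoˡ-≤ (h * h) (m≤m+n 9 41))
                 (≤-trans few-high (≤-trans m≤R (≤-trans (m≤n*m R 200) (high⇒deg² v v-high))))

  module Round (i : ℕ) (K : Subset n) (K⊆high : ∀ v → lookup K v ≡ true → high v ≡ true) where

    k : ℕ
    k = ∣ K ∣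

    K' : Subset n
    K' = K ─ L i K

    survivor : ∀ v → lookup K' v ≡ true → lookup K v ≡ true × ¬ LeMOverKT m λ' k (p i K v)
    survivor v v∈K' = v∈K , false⇒refutation (leMOverKT? m λ' k (p i K v))
                                   (trans (sym (isYes≗does (leMOverKT? m λ' k (p i K v)))) test-fails)
      where
      K'≡ : lookup K' v ≡ lookup K v ∧ not (lookup K v ∧ ⌊ leMOverKT? m λ' k (p i K v) ⌋)
      K'≡ = trans (lookup-─ K (L i K) v)
              (cong (λ b → lookup K v ∧ not b) (lookup∘tabulate (λ w → lookup K w ∧ ⌊ leMOverKT? m λ' k (p i K w) ⌋) v))
      test = ⌊ leMOverKT? m λ' k (p i K v) ⌋
      v∈K = proj₁ (∧-not-elim (lookup K v) test (trans (sym K'≡) v∈K'))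
      test-fails = proj₂ (∧-not-elim (lookup K v) test (trans (sym K'≡) v∈K'))

    K'⊆high : ∀ v → lookup K' v ≡ true → high v ≡ true
    K'⊆high v v∈K' = K⊆high v (proj₁ (survivor v v∈K'))

    c : Fin n → ℕ
    c u = ∣ N G u ∩ K ∣

    c≡sum : ∀ u → c u ≡ sum (λ w → 𝟙 (adj G u w ∧ lookup K w))
    c≡sum u = trans (∣∣≡sum (N G u ∩ K)) (sum-cong-≗ λ w →
                cong 𝟙 (trans (lookup-∩ (N G u) K w) (cong (_∧ lookup K w) (lookup∘tabulate (adj G u) w))))

    survivor-sees-expensive : ∀ v u → lookup K' v ≡ true → adj G u v ≡ true → p i K v ℚ.≤ unitcost K u →
                              m * (c u * c u) ≤ t * (k * k * λ') * (deg G u * deg G u)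
    survivor-sees-expensive v u v∈K' uv p≤cost =
      above-threshold {m} {t} {λ'} {k} (p i K v) (c u) (deg G u) c≥1 m≤2^t (proj₂ (survivor v v∈K')) p≤cost
      where
      c≥1 : 1 ≤ c u
      c≥1 = subst (1 ≤_) (sym (c≡sum u))
              (≤-trans (≤-reflexive (cong 𝟙 (sym (cong₂ _∧_ uv (proj₁ (survivor v v∈K'))))))
                       (term≤sum (λ w → 𝟙 (adj G u w ∧ lookup K w)) v))

    above : Fin n → Fin n → Bool
    above v u = inNA v u ∧ does (p i K v ℚP.≤? unitcost K u)

    counted : Fin n → Fin n → Bool
    counted v u = lookup K' v ∧ above v u

    Π : ℕ
    Π = sum (λ v → sum (λ u → 𝟙 (counted v u)))

    length-S : ∀ v → length (Smulti K v) ≡ s v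
    length-S v = trans (length-map (unitcost K) (filter (λ u → T? (inNA v u)) (allFin n)))
                 (trans (length-filter≡ (λ u → T? (inNA v u)) (allFin n))
                        (listSum-allFin (𝟙 ∘ inNA v)))

    length-above : ∀ v → length (filter (λ y → p i K v ℚP.≤? y) (Smulti K v)) ≡ sum (𝟙 ∘ above v)
    length-above v = begin
        length (filter (pᵥ ℚP.≤?_) (map (unitcost K) Nᵥ))
      ≡⟨ length-filter≡ (pᵥ ℚP.≤?_) (map (unitcost K) Nᵥ) ⟩
        listSum (map (𝟙 ∘ does ∘ (pᵥ ℚP.≤?_)) (map (unitcost K) Nᵥ))
      ≡⟨ cong listSum (map-∘ Nᵥ) ⟨
        listSum (map (𝟙 ∘ does ∘ (pᵥ ℚP.≤?_) ∘ unitcost K) Nᵥ)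
      ≡⟨ listSum-filter (λ u → T? (inNA v u)) (𝟙 ∘ does ∘ (pᵥ ℚP.≤?_) ∘ unitcost K) (allFin n) ⟩
        listSum (map (λ u → 𝟙 (inNA v u) * 𝟙 (does (pᵥ ℚP.≤? unitcost K u))) (allFin n))
      ≡⟨ listSum-allFin (λ u → 𝟙 (inNA v u) * 𝟙 (does (pᵥ ℚP.≤? unitcost K u))) ⟩
        sum (λ u → 𝟙 (inNA v u) * 𝟙 (does (pᵥ ℚP.≤? unitcost K u)))
      ≡⟨ sum-cong-≗ (λ u → 𝟙-∧ (inNA v u) (does (pᵥ ℚP.≤? unitcost K u))) ⟨
        sum (𝟙 ∘ above v) ∎
      where
      open ≡-Reasoning
      pᵥ = p i K v
      Nᵥ = filter (λ u → T? (inNA v u)) (allFin n)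

    -- p(v) is a median of S_i(v), a multiset of size s(v) ≥ 1.
    median-half : ∀ v → lookup K' v ≡ true → s v ≤ 2 * sum (𝟙 ∘ above v)
    median-half v v∈K' = subst₂ _≤_ (length-S v) (cong (2 *_) (length-above v))
                           (proj₂ (median i v (Smulti K v) S≢[]))
      where
      s≥1 : 1 ≤ s v
      s≥1 = square-cancel (≤-trans m≥1 (≤-trans m≤R (≤-trans (m≤n*m R 64) (high⇒s² v (K'⊆high v v∈K')))))
      S≢[] : Smulti K v ≢ List.[]
      S≢[] S≡[] = contradiction (trans (sym (length-S v)) (cong length S≡[])) (≢-sym (<⇒≢ s≥1))

    survivors-sum≤2Π : sum (λ v → 𝟙 (lookup K' v) * s v) ≤ 2 * Π
    survivors-sum≤2Π = begin
        sum (λ v → 𝟙 (lookup K' v) * s v)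
      ≤⟨ sum-mono-≤ (λ v → 𝟙-guard (lookup K' v) (median-half v)) ⟩
        sum (λ v → 𝟙 (lookup K' v) * (2 * sum (𝟙 ∘ above v)))
      ≡⟨ sum-cong-≗ (λ v → *-comm-2 (𝟙 (lookup K' v)) (sum (𝟙 ∘ above v))) ⟩
        sum (λ v → 2 * (𝟙 (lookup K' v) * sum (𝟙 ∘ above v)))
      ≡⟨ *-distribˡ-sum 2 (λ v → 𝟙 (lookup K' v) * sum (𝟙 ∘ above v)) ⟨
        2 * sum (λ v → 𝟙 (lookup K' v) * sum (𝟙 ∘ above v))
      ≡⟨ cong (2 *_) (sum-cong-≗ λ v → trans (*-distribˡ-sum (𝟙 (lookup K' v)) (𝟙 ∘ above v))
                                              (sum-cong-≗ λ u → sym (𝟙-∧ (lookup K' v) (above v u)))) ⟩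
        2 * Π ∎
      where
      open ≤-Reasoning
      *-comm-2 : ∀ x y → x * (2 * y) ≡ 2 * (x * y)
      *-comm-2 = solve-∀

    lower : 64 * R * (∣ K' ∣ * ∣ K' ∣) ≤ sum (λ v → 𝟙 (lookup K' v) * s v) * sum (λ v → 𝟙 (lookup K' v) * s v)
    lower = ≤-trans (≤-reflexive (cong (λ x → 64 * R * (x * x)) (∣∣≡sum K')))
              (count-sq-bound (lookup K') (64 * R) s (λ v v∈K' → high⇒s² v (K'⊆high v v∈K')))

    counted⇒ : ∀ v u → counted v u ≡ true →
               lookup K' v ≡ true × adj G u v ≡ true × p i K v ℚ.≤ unitcost K u
    counted⇒ v u counted≡true = v∈K' , trans (adj-sym G u v) vu , p≤cost
      where
      cost? = p i K v ℚP.≤? unitcost K u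
      v∈K' = proj₁ (∧-elim (lookup K' v) (above v u) counted≡true)
      above≡true = proj₂ (∧-elim (lookup K' v) (above v u) counted≡true)
      u∈NA = proj₁ (∧-elim (inNA v u) (does cost?) above≡true)
      p≤cost = true⇒witness cost? (proj₂ (∧-elim (inNA v u) (does cost?) above≡true))
      vu = proj₁ (∧-elim (adj G v u) (lookup (NSet G Vhigh) u ∧ not (high u)) (trans (sym (inNA≡ v u)) u∈NA))

    load : Fin n → ℕ
    load u = sum (λ v → 𝟙 (counted v u))

    load≤c : ∀ u → load u ≤ c u
    load≤c u = subst (load u ≤_) (sym (c≡sum u)) (sum-mono-≤ λ v → 𝟙-mono λ counted≡true →
                 let v∈K' , uv , _ = counted⇒ v u counted≡true
                 in cong₂ _∧_ uv (proj₁ (survivor v v∈K')))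

    -- A vertex u carrying any load is expensive, so its load is small relative to deg(u).
    load-bound : ∀ u → m * (load u * load u) ≤ t * (k * k * λ') * (deg G u * deg G u)
    load-bound u = sq-bound-when-pos m (t * (k * k * λ') * (deg G u * deg G u)) (load≤c u) λ load>0 →
      let v , term>0 = sum-pos⇒term-pos (λ v → 𝟙 (counted v u)) load>0
          v∈K' , uv , p≤cost = counted⇒ v u (𝟙-pos term>0)
      in survivor-sees-expensive v u v∈K' uv p≤cost

    -- Upper bound: summing the loads over u, with Σ deg = 2m.
    upper : m * (Π * Π) ≤ t * (k * k * λ') * ((2 * m) * (2 * m))
    upper = subst₂ (λ P D → m * (P * P) ≤ t * (k * k * λ') * (D * D))
              (sym (∑-comm (λ v u → 𝟙 (counted v u)))) (handshake G)
              (sum-sq-compare m (t * (k * k * λ')) load (deg G) load-bound)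

    halving : 2 * ∣ K' ∣ ≤ k
    halving = halving-arith m t λ' k ∣ K' ∣ (sum (λ v → 𝟙 (lookup K' v) * s v)) Π
                m≥1 t≥1 λ≥1 lower survivors-sum≤2Π upper

  K-after⊆high : ∀ j v → lookup (K-after j) v ≡ true → high v ≡ true
  K-after⊆high zero    v v∈K = v∈K
  K-after⊆high (suc j) v v∈K = Round.K'⊆high (suc j) (K-after j) (K-after⊆high j) v v∈K

  K-after-halves : ∀ j → ∣ K-after j ∣ * 2 ^ j ≤ h
  K-after-halves zero    = ≤-reflexive (*-identityʳ h)
  K-after-halves (suc j) = begin
      ∣ K' ∣ * (2 * 2 ^ j)   ≡⟨ *-assoc ∣ K' ∣ 2 (2 ^ j) ⟨
      ∣ K' ∣ * 2 * 2 ^ j     ≡⟨ cong (_* 2 ^ j) (*-comm ∣ K' ∣ 2) ⟩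
      2 * ∣ K' ∣ * 2 ^ j     ≤⟨ *-monoˡ-≤ (2 ^ j) (Round.halving (suc j) (K-after j) (K-after⊆high j)) ⟩
      ∣ K-after j ∣ * 2 ^ j  ≤⟨ K-after-halves j ⟩
      h                      ∎
    where
    open ≤-Reasoning
    K' = K-after (suc j)

lemma15 : ∀ {n : ℕ} (G : Graph n) (λ' : ℕ) (med : MedianChoice n) →
    2 ≤ numEdges G →
    ArboricityAtMost G λ' →
    ValidMedianChoice med →
    Stage1.K-after G λ' med ⌈log₂ numEdges G ⌉ ≡ ∅
lemma15 G λ' med m≥2 arb median =
  -- |K_{t+1}|·2^t ≤ h < m ≤ 2^t forces |K_{t+1}| = 0.
  ∣∣≡0⇒∅ (K-after t) (multiple-below (K-after-halves t) (<-≤-trans h<m m≤2^t))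
  where
  open Stage1 G λ' med using (K-after)
  open Analysis G λ' med m≥2 arb median
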